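{- For every satisfiable generalised multi-clause-set $F$ there exists a partial assignment $\varphi$ with $n(\varphi)\le \delta^*(F)$ such that $\varphi * F$ is matching satisfiable.
   Context: Each variable $v$ has a finite non-empty domain $D_v$; a literal is a pair $(v,\varepsilon)$, $\varepsilon\in D_v$, meaning "$v\ne\varepsilon$"; a clause is a finite set of literals with no two distinct literals on the same variable; a multi-clause-set $F$ is a finitely supported map from clauses to $\mathbb{N}_0$ (clause occurrences counted with multiplicity); $F'\le F$ means $F'(C)\le F(C)$ for all $C$. A partial assignment $\varphi$ maps a finite set $\mathrm{var}(\varphi)$ of variables to values in their domains, $n(\varphi)=|\mathrm{var}(\varphi)|$; it satisfies $(v,\varepsilon)$ iff $v\in\mathrm{var}(\varphi)$ and $\varphi(v)\ne\varepsilon$, falsifies it iff $\varphi(v)=\varepsilon$. $\varphi*F$ is obtained by deleting all clause occurrences containing a satisfied literal and removing falsified literals from the remaining occurrences (multiplicities add up). $F$ is satisfiable iff some $\varphi$ satisfies all its clauses. $c(F)=\sum_C F(C)$, $\mathrm{rd}(F)=\sum_{v\in\mathrm{var}(F)}(|D_v|-1)$, deficiency $\delta(F)=c(F)-\mathrm{rd}(F)$, maximal deficiency $\delta^*(F)=\max_{F'\le F}\delta(F')$. $F$ is matching satisfiable iff $F=F_1+\dots+F_m$ ($m\ge 0$) for multi-clause-sets $F_i$ and pairwise distinct variables $v_1,\dots,v_m$ such that $v_i$ occurs in every clause of $F_i$ and $|D_{v_i}|>c(F_i)$ (equivalently: the bipartite graph with clause-nodes $(C,i)$, $i\le F(C)$,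 and variable-nodes $(v,j)$, $j\le|D_v|-1$, adjacent iff $v\in\mathrm{var}(C)$, has a matching covering all clause-nodes). -}

module Defs where

open import Data.Bool using (Bool; true; false; not; T; _∧_)
open import Data.Nat as ℕ using (ℕ; _<_; _∸_; _≡ᵇ_; _≟_)
open import Data.Integer as ℤ using (ℤ; +_; _-_; _⊔_)
open import Data.List using (List; []; _∷_; map; length; concat; concatMap; foldr; filter; _++_; deduplicate)
open import Data.Bool.ListAction using (any)
open import Data.Nat.ListAction using (sum)
open import Data.List.Relation.Unary.All using (All)
open import Data.List.Relation.Unary.Unique.Propositional using (Unique)
open import Data.List.Relation.Binary.Permutation.Propositional using (_↭_)
open import Data.List.Membership.Propositional using (_∈_)
open import Data.Maybe using (Maybe; just; nothing)
open import Data.Product using (_×_; _,_; proj₁; proj₂; Σ)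
open import Relation.Nullary.Decidable using (T?)
open import Relation.Unary using (Decidable)

-- Variables are natural numbers.  A domain-size function  dom : ℕ → ℕ
-- gives |D_v| = dom v, and D_v = {0, …, dom v - 1}.

-- A literal (v , ε) means "v ≠ ε".
Literal : Set
Literal = ℕ × ℕ

Clause : Set
Clause = List Literal

-- A multi-clause-set is a list of clause occurrences (a multiset).
MCS : Set
MCS = List Clause

WFClause : (ℕ → ℕ) → Clause → Set
WFClause dom C = All (λ l → proj₂ l < dom (proj₁ l)) C × Unique (map proj₁ C)

WFMCS : (ℕ → ℕ) → MCS → Set
WFMCS dom F = All (WFClause dom) F

PAss : Set
PAss = List (ℕ × ℕ)

WFPAss : (ℕ → ℕ) → PAss → Set
WFPAss dom φ = All (λ p → proj₂ p < dom (proj₁ p)) φ × Unique (map proj₁ φ)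

nvar : PAss → ℕ
nvar φ = length φ

look : PAss → ℕ → Maybe ℕ
look [] v = nothing
look ((w , x) ∷ φ) v with v ≡ᵇ w
... | true  = just x
... | false = look φ v

satLit : PAss → Literal → Bool
satLit φ (v , ε) with look φ v
... | just x  = not (x ≡ᵇ ε)
... | nothing = false

falLit : PAss → Literal → Bool
falLit φ (v , ε) with look φ v
... | just x  = x ≡ᵇ ε
... | nothing = false

applyClause : PAss → Clause → List Clause
applyClause φ C with any (satLit φ) C
... | true  = []
... | false = filter (λ l → T? (not (falLit φ l))) C ∷ []

apply : PAss → MCS → MCS
apply φ F = concatMap (applyClause φ) F

Satisfiable : (ℕ → ℕ) → MCS → Set
Satisfiable dom F = Σ PAss λ φ → WFPAss dom φ × All (λ C → T (any (satLit φ) C)) F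

c : MCS → ℕ
c F = length F

vars : MCS → List ℕ
vars F = deduplicate _≟_ (concatMap (map proj₁) F)

rd : (ℕ → ℕ) → MCS → ℕ
rd dom F = sum (map (λ v → dom v ∸ 1) (vars F))

δ : (ℕ → ℕ) → MCS → ℤ
δ dom F = + c F - + rd dom F

-- all sub-multisets F' ≤ F (as sublists of the occurrence list)
subs : {A : Set} → List A → List (List A)
subs [] = [] ∷ []
subs (x ∷ xs) = map (x ∷_) (subs xs) ++ subs xs

-- δ*(F) = max_{F' ≤ F} δ(F')   (δ([]) = 0 is included)
δ* : (ℕ → ℕ) → MCS → ℤ
δ* dom F = foldr _⊔_ (δ dom []) (map (δ dom) (subs F))

-- matching satisfiable: F = F_1 + … + F_m with pairwise distinct v_i,
-- v_i occurring in every clause of F_i, and |D_{v_i}| > c(F_i)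
MatchingSat : (ℕ → ℕ) → MCS → Set
MatchingSat dom F =
  Σ (List (ℕ × MCS)) λ parts →
      Unique (map proj₁ parts)
    × (concat (map proj₂ parts) ↭ F)
    × All (λ p → All (λ C → proj₁ p ∈ map proj₁ C) (proj₂ p) × (c (proj₂ p) < dom (proj₁ p))) parts

-- Fix a satisfying assignment ψ and view every clause C as a node whose neighbours are var(C)
-- and whose good variables are those ψ makes true.  With capacity |D_v| − 1 on each variable,
-- δ*(F) ≤ d says that every sub-multi-clause-set S has c(S) ≤ cap(var(S)) + d, a deficient Hall
-- condition.  By induction on c(F) one chooses at most d good variables V and matches every
-- clause not hit by V to a neighbour outside V, using each variable v at most |D_v| − 1 times.
-- If some proper part S is tight (c(S) = cap(var(S)) + d), solve S, and solve the rest with the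
-- variables of S removed and deficiency 0.  Otherwise the first clause is matched to a neighbour of
-- positive capacity (a good one if d > 0); if all its good variables have capacity 0, one of them
-- is put into V: deleting it and the clauses it hits costs only one unit of deficiency, because
-- no part is tight.  Then φ := ψ restricted to V satisfies exactly the clauses hit by V, every
-- other clause keeps its partner, and grouping clauses by partner shows that φ * F is matching
-- satisfiable.
module Submission where

open import Defs
open import Data.Bool using (Bool; true; false; T; not)
open import Data.Bool.ListAction using (any)
open import Data.Empty using (⊥-elim)
open import Data.Fin.Subset.Properties using (anySubset?)
open import Data.Integer as ℤ using (ℤ)
import Data.Integer.Properties as ℤ
open import Data.List using (List; []; _∷_; length; map; filter; _++_; concat; concatMap; foldr; deduplicate)
open import Data.List.Properties using (length-map; length-filter; map-∘; map-id)
open import Data.List.Membership.Propositional using (_∈_; _∉_; find; lose)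
open import Data.List.Membership.Propositional.Properties
  using ( ∈-filter⁺; ∈-filter⁻; ∈-map⁺; ∈-map⁻; ∈-map∘filter⁻; ∈-concatMap⁺; ∈-concatMap⁻; ∈-deduplicate⁻
        ; ∈-++⁺ˡ; ∈-++⁺ʳ)
open import Data.List.Relation.Binary.Permutation.Propositional using (_↭_; ↭-refl; ↭-prep; ↭-trans)
open import Data.List.Relation.Binary.Permutation.Propositional.Properties using (++⁺ˡ; shift)
open import Data.List.Relation.Binary.Pointwise using (Pointwise; []; _∷_)
open import Data.List.Relation.Binary.Subset.Propositional using (_⊆_)
open import Data.List.Relation.Unary.All using (All; []; _∷_; zip; tabulate) renaming (map to mapAll)
import Data.List.Relation.Unary.All.Properties as All
open import Data.List.Relation.Unary.All.Properties using (¬Any⇒All¬; All¬⇒¬Any)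
open import Data.List.Relation.Unary.AllPairs using ([]; _∷_)
open import Data.List.Relation.Unary.Any using (Any; here; there; any?; satisfied) renaming (map to mapAny)
import Data.List.Relation.Unary.Any.Properties as Any
open import Data.List.Relation.Unary.Unique.Propositional using (Unique)
open import Data.Maybe using (Maybe; just; nothing; fromMaybe)
open import Data.Nat using (ℕ; zero; suc; _+_; _∸_; _≤_; _<_; z≤n; s≤s; s≤s⁻¹; _≟_; _≤?_; _<?_; _≡ᵇ_)
open import Data.Nat.ListAction using (sum)
open import Data.Nat.Properties
open import Data.List.Membership.DecPropositional _≟_ using (_∈?_)
open import Data.List.Relation.Unary.Unique.DecPropositional.Properties _≟_ using (deduplicate-!)
open import Data.Product using (Σ; ∃; _×_; _,_; proj₁; proj₂)
open import Data.Sum using (_⊎_; inj₁; inj₂; [_,_])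
open import Data.Unit using (tt)
open import Data.Vec using (Vec; toList) renaming ([] to []ᵛ; _∷_ to _∷ᵛ_)
open import Function using (_∘_)
open import Relation.Nullary using (Dec; yes; no; ¬_; ¬?; _×-dec_)
open import Relation.Nullary.Decidable using (T?)
open import Relation.Unary using (Decidable)
open import Relation.Binary.PropositionalEquality using (_≡_; _≢_; refl; sym; trans; cong; subst)
open import Algebra.Properties.CommutativeSemigroup +-commutativeSemigroup using (interchange; x∙yz≈y∙xz; xy∙z≈xz∙y)
open import Algebra.Properties.AbelianGroup ℤ.+-0-abelianGroup using (//-rightDividesˡ)

private
  variable
    A C : Set
    P : A → Set

indicator : {Q : Set} → Dec Q → ℕ → ℕ
indicator (yes _) x = x
indicator (no _)  _ = 0

indicator-≤ : ∀ {Q} (q : Dec Q) x → indicator q x ≤ x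
indicator-≤ (yes _) x = ≤-refl
indicator-≤ (no _)  x = z≤n

indicator-mono : ∀ {Q R} (q : Dec Q) (r : Dec R) → (Q → R) → ∀ x → indicator q x ≤ indicator r x
indicator-mono (yes q) (yes _) _   x = ≤-refl
indicator-mono (yes q) (no ¬r) q⇒r x = ⊥-elim (¬r (q⇒r q))
indicator-mono (no _)  _       _   x = z≤n

indicator-positive : ∀ {Q} (q : Dec Q) {x} → 0 < indicator q x → Q × 0 < x
indicator-positive (yes q) pos = q , pos

indicator-+ : ∀ {Q R S} (q : Dec Q) (r : Dec R) (s : Dec S) →
  (Q → S) → (R → S) → (Q → ¬ R) → ∀ x → indicator q x + indicator r x ≤ indicator s x
indicator-+ (yes q) (yes r) _       _   _   q#r x = ⊥-elim (q#r q r)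
indicator-+ (yes _) (no _)  (yes _) _   _   _   x = ≤-reflexive (+-identityʳ x)
indicator-+ (yes q) (no _)  (no ¬s) q⇒s _   _   x = ⊥-elim (¬s (q⇒s q))
indicator-+ (no _)  (yes _) (yes _) _   _   _   x = ≤-refl
indicator-+ (no _)  (yes r) (no ¬s) _   r⇒s _   x = ⊥-elim (¬s (r⇒s r))
indicator-+ (no _)  (no _)  _       _   _   _   x = z≤n

indicator-split : ∀ {Q R S} (q : Dec Q) (r : Dec R) (s : Dec S) →
  (Q → R ⊎ S) → ∀ x → indicator q x ≤ indicator r x + indicator s (indicator (¬? r) x)
indicator-split q       (yes _) _       _    x = ≤-trans (indicator-≤ q x) (m≤m+n x _)
indicator-split (no _)  (no _)  _       _    x = z≤n
indicator-split (yes _) (no _)  (yes _) _    x = ≤-refl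
indicator-split (yes q) (no ¬r) (no ¬s) q⇒rs x with q⇒rs q
... | inj₁ r = ⊥-elim (¬r r)
... | inj₂ s = ⊥-elim (¬s s)

sumBelow : ℕ → (ℕ → ℕ) → ℕ
sumBelow zero    f = 0
sumBelow (suc n) f = f n + sumBelow n f

sumBelow-mono-≤ : ∀ n {f g : ℕ → ℕ} → (∀ u → f u ≤ g u) → sumBelow n f ≤ sumBelow n g
sumBelow-mono-≤ zero    _   = z≤n
sumBelow-mono-≤ (suc n) f≤g = +-mono-≤ (f≤g n) (sumBelow-mono-≤ n f≤g)

sumBelow-+ : ∀ n (f g : ℕ → ℕ) → sumBelow n (λ u → f u + g u) ≡ sumBelow n f + sumBelow n g
sumBelow-+ zero    f g = refl
sumBelow-+ (suc n) f g =
  trans (cong (f n + g n +_) (sumBelow-+ n f g)) (interchange (f n) (g n) (sumBelow n f) (sumBelow n g))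

sumBelow-≤-+ : ∀ n {f g h : ℕ → ℕ} → (∀ u → f u ≤ g u + h u) → sumBelow n f ≤ sumBelow n g + sumBelow n h
sumBelow-≤-+ n {g = g} {h} f≤g+h = ≤-trans (sumBelow-mono-≤ n f≤g+h) (≤-reflexive (sumBelow-+ n g h))

sumBelow-positive : ∀ n (f : ℕ → ℕ) → 0 < sumBelow n f → ∃ λ u → 0 < f u
sumBelow-positive (suc n) f pos with f n in eq
... | zero  = sumBelow-positive n f pos
... | suc _ = n , subst (0 <_) (sym eq) (s≤s z≤n)

sumBelow-at-≡0 : ∀ n (f : ℕ → ℕ) {v} → n ≤ v → sumBelow n (λ u → indicator (u ≟ v) (f u)) ≡ 0
sumBelow-at-≡0 zero    f n≤v = refl
sumBelow-at-≡0 (suc n) f {v} n<v with n ≟ v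
... | yes refl = ⊥-elim (<-irrefl refl n<v)
... | no _     = sumBelow-at-≡0 n f (<⇒≤ n<v)

sumBelow-at-≤ : ∀ n (f : ℕ → ℕ) v → sumBelow n (λ u → indicator (u ≟ v) (f u)) ≤ f v
sumBelow-at-≤ zero    f v = z≤n
sumBelow-at-≤ (suc n) f v with n ≟ v
... | yes refl = ≤-reflexive (trans (cong (f n +_) (sumBelow-at-≡0 n f ≤-refl)) (+-identityʳ (f n)))
... | no _     = sumBelow-at-≤ n f v

sumBelow-at-≥ : ∀ n (f : ℕ → ℕ) {v} → v < n → f v ≤ sumBelow n (λ u → indicator (u ≟ v) (f u))
sumBelow-at-≥ (suc n) f {v} v<1+n with n ≟ v
... | yes refl = m≤m+n (f n) _
... | no n≢v   = sumBelow-at-≥ n f (≤∧≢⇒< (s≤s⁻¹ v<1+n) (n≢v ∘ sym))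

-- Sub-multisets as masks

-- Positions beyond the end of a mask count as unselected.
select : List Bool → List A → List A
select []          _        = []
select (_ ∷ _)     []       = []
select (true ∷ m)  (x ∷ xs) = x ∷ select m xs
select (false ∷ m) (x ∷ xs) = select m xs

reject : List Bool → List A → List A
reject []          xs       = xs
reject (_ ∷ _)     []       = []
reject (true ∷ m)  (x ∷ xs) = reject m xs
reject (false ∷ m) (x ∷ xs) = x ∷ reject m xs

select-[] : ∀ m → select {A} m [] ≡ []
select-[] []      = refl
select-[] (_ ∷ _) = refl

length-select+reject : ∀ m (xs : List A) → length (select m xs) + length (reject m xs) ≡ length xs
length-select+reject []          xs       = refl
length-select+reject (_ ∷ _)     []       = refl
length-select+reject (true ∷ m)  (x ∷ xs) = cong suc (length-select+reject m xs)
length-select+reject (false ∷ m) (x ∷ xs) = trans (+-suc _ _) (cong suc (length-select+reject m xs))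

select-All : ∀ m {xs : List A} → All P xs → All P (select m xs)
select-All []          _        = []
select-All (_ ∷ _)     []       = []
select-All (true ∷ m)  (p ∷ ps) = p ∷ select-All m ps
select-All (false ∷ m) (_ ∷ ps) = select-All m ps

reject-All : ∀ m {xs : List A} → All P xs → All P (reject m xs)
reject-All []          ps       = ps
reject-All (_ ∷ _)     []       = []
reject-All (true ∷ m)  (_ ∷ ps) = reject-All m ps
reject-All (false ∷ m) (p ∷ ps) = p ∷ reject-All m ps

select-Any : ∀ m (xs : List A) → Any P (select m xs) → Any P xs
select-Any (true ∷ m)  (x ∷ xs) (here p)  = here p
select-Any (true ∷ m)  (x ∷ xs) (there p) = there (select-Any m xs p)
select-Any (false ∷ m) (x ∷ xs) p         = there (select-Any m xs p)

select-map : ∀ (f : A → C) m xs → select m (map f xs) ≡ map f (select m xs)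
select-map f []          xs       = refl
select-map f (_ ∷ _)     []       = refl
select-map f (true ∷ m)  (x ∷ xs) = cong (f x ∷_) (select-map f m xs)
select-map f (false ∷ m) (x ∷ xs) = select-map f m xs

select-filter : (P? : Decidable P) → ∀ m xs → ∃ λ m₀ → select m (filter P? xs) ≡ select m₀ xs
select-filter P? m [] = [] , select-[] m
select-filter P? m (x ∷ xs) with P? x
select-filter P? m           (x ∷ xs) | no _  = let m₀ , eq = select-filter P? m xs in false ∷ m₀ , eq
select-filter P? []          (x ∷ xs) | yes _ = [] , refl
select-filter P? (true ∷ m)  (x ∷ xs) | yes _ =
  let m₀ , eq = select-filter P? m xs in true ∷ m₀ , cong (x ∷_) eq
select-filter P? (false ∷ m) (x ∷ xs) | yes _ = let m₀ , eq = select-filter P? m xs in false ∷ m₀ , eq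

select∈subs : ∀ m (xs : List A) → select m xs ∈ subs xs
select∈subs []          []       = here refl
select∈subs (_ ∷ _)     []       = here refl
select∈subs []          (x ∷ xs) = ∈-++⁺ʳ _ (select∈subs [] xs)
select∈subs (true ∷ m)  (x ∷ xs) = ∈-++⁺ˡ (∈-map⁺ (x ∷_) (select∈subs m xs))
select∈subs (false ∷ m) (x ∷ xs) = ∈-++⁺ʳ _ (select∈subs m xs)

fit : (k : ℕ) → List Bool → Vec Bool k
fit zero    _       = []ᵛ
fit (suc k) []      = false ∷ᵛ fit k []
fit (suc k) (b ∷ m) = b ∷ᵛ fit k m

select-fit : ∀ m (xs : List A) → select (toList (fit (length xs) m)) xs ≡ select m xs
select-fit []          []       = refl
select-fit (_ ∷ _)     []       = refl
select-fit []          (x ∷ xs) = select-fit [] xs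
select-fit (true ∷ m)  (x ∷ xs) = cong (x ∷_) (select-fit m xs)
select-fit (false ∷ m) (x ∷ xs) = select-fit m xs

compose : List Bool → List Bool → List Bool
compose []          _        = []
compose (true ∷ m)  []       = []
compose (true ∷ m)  (b ∷ m') = b ∷ compose m m'
compose (false ∷ m) m'       = false ∷ compose m m'

select-compose : ∀ m m' (xs : List A) → select m' (select m xs) ≡ select (compose m m') xs
select-compose []          []        xs       = refl
select-compose []          (_ ∷ _)   xs       = refl
select-compose (b ∷ m)     m'        []       = trans (select-[] m') (sym (select-[] (compose (b ∷ m) m')))
select-compose (true ∷ m)  []        (x ∷ xs) = refl
select-compose (true ∷ m)  (true ∷ m')  (x ∷ xs) = cong (x ∷_) (select-compose m m' xs)
select-compose (true ∷ m)  (false ∷ m') (x ∷ xs) = select-compose m m' xs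
select-compose (false ∷ m) m'        (x ∷ xs) = select-compose m m' xs

-- combine m m' selects what m selects together with what m' selects from reject m xs.
combine : List Bool → List Bool → List Bool
combine []          m'       = m'
combine (true ∷ m)  m'       = true ∷ combine m m'
combine (false ∷ m) []       = false ∷ combine m []
combine (false ∷ m) (b ∷ m') = b ∷ combine m m'

length-combine : ∀ m m' (xs : List A) →
  length (select (combine m m') xs) ≡ length (select m xs) + length (select m' (reject m xs))
length-combine []          m'          xs       = refl
length-combine (true ∷ m)  []          []       = refl
length-combine (true ∷ m)  (_ ∷ _)     []       = refl
length-combine (false ∷ m) []          []       = refl
length-combine (false ∷ m) (_ ∷ _)     []       = refl
length-combine (true ∷ m)  m'          (x ∷ xs) = cong suc (length-combine m m' xs)
length-combine (false ∷ m) []          (x ∷ xs) = length-combine m [] xs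
length-combine (false ∷ m) (true ∷ m') (x ∷ xs) = trans (cong suc (length-combine m m' xs)) (sym (+-suc _ _))
length-combine (false ∷ m) (false ∷ m') (x ∷ xs) = length-combine m m' xs

Any-combine : ∀ m m' (xs : List A) →
  Any P (select (combine m m') xs) → Any P (select m xs) ⊎ Any P (select m' (reject m xs))
Any-combine []          m'          xs       p         = inj₂ p
Any-combine (true ∷ m)  m'          (x ∷ xs) (here p)  = inj₁ (here p)
Any-combine (true ∷ m)  m'          (x ∷ xs) (there p) with Any-combine m m' xs p
... | inj₁ q = inj₁ (there q)
... | inj₂ q = inj₂ q
Any-combine (false ∷ m) []          (x ∷ xs) p         = Any-combine m [] xs p
Any-combine (false ∷ m) (true ∷ m') (x ∷ xs) (here p)  = inj₂ (here p)
Any-combine (false ∷ m) (true ∷ m') (x ∷ xs) (there p) with Any-combine m m' xs p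
... | inj₁ q = inj₁ q
... | inj₂ q = inj₂ (there q)
Any-combine (false ∷ m) (false ∷ m') (x ∷ xs) p        = Any-combine m m' xs p

interleave : List Bool → List A → List A → List A
interleave (true ∷ m)  (a ∷ as) bs       = a ∷ interleave m as bs
interleave (false ∷ m) as       (b ∷ bs) = b ∷ interleave m as bs
interleave _           as       bs       = as ++ bs

Pointwise-interleave : ∀ {R : A → C → Set} m xs {as bs} →
  Pointwise R (select m xs) as → Pointwise R (reject m xs) bs → Pointwise R xs (interleave m as bs)
Pointwise-interleave []          xs       []       rs       = rs
Pointwise-interleave (true ∷ m)  []       []       []       = []
Pointwise-interleave (false ∷ m) []       []       []       = []
Pointwise-interleave (true ∷ m)  (x ∷ xs) (r ∷ rs) rs'      = r ∷ Pointwise-interleave m xs rs rs'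
Pointwise-interleave (false ∷ m) (x ∷ xs) rs       (r ∷ rs') = r ∷ Pointwise-interleave m xs rs rs'

record Node : Set where
  constructor node
  field
    nbrs : List ℕ
    good : List ℕ
open Node

WellFormed : Node → Set
WellFormed nd = good nd ⊆ nbrs nd × ∃ (_∈ good nd)

Occurs : ℕ → List Node → Set
Occurs u F = Any (λ nd → u ∈ nbrs nd) F

occurs? : ∀ u F → Dec (Occurs u F)
occurs? u F = any? (λ nd → u ∈? nbrs nd) F

IsGood : ℕ → List Node → Set
IsGood x F = Any (λ nd → x ∈ good nd) F

IsGood⇒Occurs : ∀ {x F} → All WellFormed F → IsGood x F → Occurs x F
IsGood⇒Occurs ((good⊆nbrs , _) ∷ _) (here x∈) = here (good⊆nbrs x∈)
IsGood⇒Occurs (_ ∷ wf)              (there p) = there (IsGood⇒Occurs wf p)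

Hit : List ℕ → Node → Set
Hit V nd = Any (_∈ V) (good nd)

hit? : ∀ V nd → Dec (Hit V nd)
hit? V nd = any? (_∈? V) (good nd)

¬Hit[] : ∀ {nd} → ¬ Hit [] nd
¬Hit[] h with satisfied h
... | _ , ()

data Served (V : List ℕ) (nd : Node) : Maybe ℕ → Set where
  hit     : Hit V nd → Served V nd nothing
  matched : ∀ {w} → w ∈ nbrs nd → w ∉ V → ¬ Hit V nd → Served V nd (just w)

uses : ℕ → List (Maybe ℕ) → ℕ
uses w []             = 0
uses w (nothing ∷ as) = uses w as
uses w (just x ∷ as)  = indicator (w ≟ x) 1 + uses w as

uses-∷ : ∀ w a as → uses w as ≤ uses w (a ∷ as)
uses-∷ w nothing  as = ≤-refl
uses-∷ w (just x) as = m≤n+m _ _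

uses-∷-mono : ∀ w a {as bs} → uses w as ≤ uses w bs → uses w (a ∷ as) ≤ uses w (a ∷ bs)
uses-∷-mono w nothing  le = le
uses-∷-mono w (just x) le = +-monoʳ-≤ _ le

uses-self : ∀ w as → uses w (just w ∷ as) ≡ suc (uses w as)
uses-self w as with w ≟ w
... | yes _  = refl
... | no w≢w = ⊥-elim (w≢w refl)

uses-++ : ∀ w as bs → uses w (as ++ bs) ≡ uses w as + uses w bs
uses-++ w []             bs = refl
uses-++ w (nothing ∷ as) bs = uses-++ w as bs
uses-++ w (just x ∷ as)  bs =
  trans (cong (indicator (w ≟ x) 1 +_) (uses-++ w as bs)) (sym (+-assoc (indicator (w ≟ x) 1) _ _))

uses-interleave : ∀ w m as bs → uses w (interleave m as bs) ≡ uses w as + uses w bs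
uses-interleave w []          as             bs             = uses-++ w as bs
uses-interleave w (true ∷ m)  []             bs             = refl
uses-interleave w (true ∷ m)  (nothing ∷ as) bs             = uses-interleave w m as bs
uses-interleave w (true ∷ m)  (just x ∷ as)  bs             =
  trans (cong (indicator (w ≟ x) 1 +_) (uses-interleave w m as bs)) (sym (+-assoc (indicator (w ≟ x) 1) _ _))
uses-interleave w (false ∷ m) as             []             = uses-++ w as []
uses-interleave w (false ∷ m) as             (nothing ∷ bs) = uses-interleave w m as bs
uses-interleave w (false ∷ m) as             (just x ∷ bs)  =
  trans (cong (indicator (w ≟ x) 1 +_) (uses-interleave w m as bs))
        (x∙yz≈y∙xz (indicator (w ≟ x) 1) (uses w as) (uses w bs))

uses-absent : ∀ {V w} F {as} → Pointwise (Served V) F as → ¬ Occurs w F → uses w as ≡ 0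
uses-absent []       []                        _  = refl
uses-absent (nd ∷ F) (hit _ ∷ ss)              w∉ = uses-absent F ss (w∉ ∘ there)
uses-absent {w = w} (nd ∷ F) (matched {x} x∈ _ _ ∷ ss) w∉ with w ≟ x
... | yes refl = ⊥-elim (w∉ (here x∈))
... | no _     = uses-absent F ss (w∉ ∘ there)

strip : ℕ → Node → Node
strip g nd = node (filter (¬? ∘ (_≟ g)) (nbrs nd)) (good nd)

unhit? : ∀ g nd → Dec (g ∉ good nd)
unhit? g nd = ¬? (g ∈? good nd)

delete : ℕ → List Node → List Node
delete g F = map (strip g) (filter (unhit? g) F)

length-delete : ∀ g F → length (delete g F) ≤ length F
length-delete g F =
  ≤-trans (≤-reflexive (length-map (strip g) (filter (unhit? g) F))) (length-filter (unhit? g) F)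

WellFormed-delete : ∀ g {F} → All WellFormed F → All WellFormed (delete g F)
WellFormed-delete g {F} wf =
  All.gmap⁺ strip-wf (zip (All.filter⁺ (unhit? g) wf , All.all-filter (unhit? g) F))
  where
  strip-wf : ∀ {nd} → WellFormed nd × g ∉ good nd → WellFormed (strip g nd)
  strip-wf ((good⊆nbrs , nonEmpty) , g∉) =
    (λ x∈ → ∈-filter⁺ (¬? ∘ (_≟ g)) (good⊆nbrs x∈) λ { refl → g∉ x∈ }) , nonEmpty

¬IsGood-delete : ∀ g F → ¬ IsGood g (delete g F)
¬IsGood-delete g F p = All¬⇒¬Any (All.all-filter (unhit? g) F) (Any.map⁻ p)

IsGood-delete⁻ : ∀ {x} g F → IsGood x (delete g F) → IsGood x F
IsGood-delete⁻ g F p = Any.filter⁻ (unhit? g) (Any.map⁻ p)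

Occurs-strip : ∀ {u} g S → Occurs u S → u ≢ g → Occurs u (map (strip g) S)
Occurs-strip g S occ u≢g = Any.map⁺ (mapAny (λ u∈ → ∈-filter⁺ (¬? ∘ (_≟ g)) u∈ u≢g) occ)

select-delete : ∀ g m F → ∃ λ m₀ → select m (delete g F) ≡ map (strip g) (select m₀ F)
select-delete g m F =
  let m₀ , eq = select-filter (unhit? g) m F in
  m₀ , trans (select-map (strip g) m _) (cong (map (strip g)) eq)

Served-strip : ∀ {g V nd a} → g ∉ good nd → Served V (strip g nd) a → Served (g ∷ V) nd a
Served-strip g∉ (hit h) = hit (mapAny there h)
Served-strip {g} {V} {nd} g∉ (matched w∈ w∉ ¬h) =
  matched (proj₁ (∈-filter⁻ (¬? ∘ (_≟ g)) w∈)) w∉g∷V ¬h′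
  where
  w∉g∷V : _ ∉ g ∷ V
  w∉g∷V (here w≡g)  = proj₂ (∈-filter⁻ (¬? ∘ (_≟ g)) {xs = nbrs nd} w∈) w≡g
  w∉g∷V (there w∈V) = w∉ w∈V
  ¬h′ : ¬ Hit (g ∷ V) nd
  ¬h′ h with find h
  ... | _ , x∈ , here refl  = g∉ x∈
  ... | _ , x∈ , there x∈V = ¬h (lose x∈ x∈V)

reinstate : ∀ {V} g F {as} → Pointwise (Served V) (delete g F) as →
            ∃ λ as' → Pointwise (Served (g ∷ V)) F as' × (∀ w → uses w as' ≤ uses w as)
reinstate g [] [] = [] , [] , λ _ → z≤n
reinstate g (nd ∷ F) ss with g ∈? good nd
... | yes g∈ = let as' , ss' , fewer = reinstate g F ss in
               nothing ∷ as' , hit (lose g∈ (here refl)) ∷ ss' , fewer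
reinstate g (nd ∷ F) {a ∷ _} (s ∷ ss) | no g∉ =
  let as' , ss' , fewer = reinstate g F ss in
  a ∷ as' , Served-strip g∉ s ∷ ss' , λ w → uses-∷-mono w a {as'} (fewer w)

≤-if-positive : ∀ {n k} → (0 < n → n ≤ k) → n ≤ k
≤-if-positive {zero}  _ = z≤n
≤-if-positive {suc n} h = h (s≤s z≤n)

∉-short : ∀ {v} {V : List ℕ} → length V ≤ 0 → v ∉ V
∉-short {V = []} _ ()

-- A deficient Hall theorem with chosen variables

-- Only variables below B contribute to a capacity.
module DeficientHall (B : ℕ) where

  capacity : (ℕ → ℕ) → List Node → ℕ
  capacity cap S = sumBelow B (λ u → indicator (occurs? u S) (cap u))

  Hall : (ℕ → ℕ) → ℕ → List Node → Set
  Hall cap d F = ∀ m → length (select m F) ≤ capacity cap (select m F) + d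

  StrictHall : (ℕ → ℕ) → ℕ → List Node → Set
  StrictHall cap d F = ∀ m → 0 < length (select m F) → length (select m F) < capacity cap (select m F) + d

  record Solution (cap : ℕ → ℕ) (d : ℕ) (F : List Node) : Set where
    field
      chosen        : List ℕ
      partners      : List (Maybe ℕ)
      chosen-unique : Unique chosen
      chosen-few    : length chosen ≤ d
      chosen-good   : ∀ {x} → x ∈ chosen → IsGood x F
      served        : Pointwise (Served chosen) F partners
      within        : ∀ w → uses w partners ≤ cap w
  open Solution

  SolvableBelow : ℕ → Set
  SolvableBelow n = ∀ cap d F → length F ≤ n → All WellFormed F → Hall cap d F → Solution cap d F

  -- Splitting along a tight part S: S keeps deficiency d, the rest loses the neighbours of S.

  _without_ : (ℕ → ℕ) → List Node → ℕ → ℕ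
  (cap without S) u = indicator (¬? (occurs? u S)) (cap u)

  Hall-select : ∀ {cap d} F m → Hall cap d F → Hall cap d (select m F)
  Hall-select F m hall m' rewrite select-compose m m' F = hall (compose m m')

  capacity-combine : ∀ cap F m m' →
    capacity cap (select (combine m m') F) ≤
    capacity cap (select m F) + capacity (cap without select m F) (select m' (reject m F))
  capacity-combine cap F m m' =
    sumBelow-≤-+ B λ u →
      indicator-split (occurs? u _) (occurs? u _) (occurs? u _) (Any-combine m m' F) (cap u)

  Hall-reject : ∀ {cap d} F m → Hall cap d F → capacity cap (select m F) + d ≤ length (select m F) →
                Hall (cap without select m F) 0 (reject m F)
  Hall-reject {cap} {d} F m hall tight m' = +-cancelˡ-≤ (length S) _ _ (begin
      length S + length T'                           ≡⟨ length-combine m m' F ⟨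
      length (select (combine m m') F)               ≤⟨ hall (combine m m') ⟩
      capacity cap (select (combine m m') F) + d     ≤⟨ +-monoˡ-≤ d (capacity-combine cap F m m') ⟩
      capacity cap S + capacity cap' T' + d          ≡⟨ xy∙z≈xz∙y (capacity cap S) _ d ⟩
      capacity cap S + d + capacity cap' T'          ≤⟨ +-monoˡ-≤ _ tight ⟩
      length S + capacity cap' T'                    ≡⟨ cong (length S +_) (+-identityʳ _) ⟨
      length S + (capacity cap' T' + 0)              ∎)
    where
    open ≤-Reasoning
    S T' : List Node
    S = select m F
    T' = select m' (reject m F)
    cap' : ℕ → ℕ
    cap' = cap without S

  none-chosen : ∀ {cap F} (sol : Solution cap 0 F) → Pointwise (Served []) F (partners sol)
  none-chosen sol with chosen sol | chosen-few sol | served sol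
  ... | [] | _ | ss = ss

  serve-by : ∀ V F {as} → Pointwise (Served []) F as → (∀ w → 0 < uses w as → w ∉ V) →
             ∃ λ as' → Pointwise (Served V) F as' × (∀ w → uses w as' ≤ uses w as)
  serve-by V []       []          _ = [] , [] , λ _ → z≤n
  serve-by V (nd ∷ F) (hit h ∷ _) _ = ⊥-elim (¬Hit[] {nd} h)
  serve-by V (nd ∷ F) {just w ∷ as} (matched w∈ _ _ ∷ ss) free
    with serve-by V F ss (λ u pos → free u (<-≤-trans pos (uses-∷ u (just w) as))) | hit? V nd
  ... | as' , ss' , fewer | yes h =
        nothing ∷ as' , hit h ∷ ss' , λ u → ≤-trans (fewer u) (uses-∷ u (just w) as)
  ... | as' , ss' , fewer | no ¬h =
        just w ∷ as' , matched w∈ (free w (subst (0 <_) (sym (uses-self w as)) (s≤s z≤n))) ¬h ∷ ss' ,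
        λ u → uses-∷-mono u (just w) {as'} {as} (fewer u)

  join : ∀ {cap d} F m → All WellFormed (select m F) →
         Solution cap d (select m F) → Solution (cap without select m F) 0 (reject m F) → Solution cap d F
  join {cap} {d} F m wfS solS solR = record
    { chosen        = chosen solS
    ; partners      = interleave m (partners solS) asR
    ; chosen-unique = chosen-unique solS
    ; chosen-few    = chosen-few solS
    ; chosen-good   = select-Any m F ∘ chosen-good solS
    ; served        = Pointwise-interleave m F (served solS) servedR
    ; within        = λ w → ≤-trans (≤-reflexive (uses-interleave w m (partners solS) asR)) (joint-within w)
    }
    where
    S : List Node
    S = select m F
    free : ∀ w → 0 < uses w (partners solR) → w ∉ chosen solS
    free w pos w∈ = proj₁ (indicator-positive (¬? (occurs? w S)) (<-≤-trans pos (within solR w)))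
                          (IsGood⇒Occurs wfS (chosen-good solS w∈))
    reserved : ∃ λ as → Pointwise (Served (chosen solS)) (reject m F) as ×
                        (∀ w → uses w as ≤ uses w (partners solR))
    reserved = serve-by (chosen solS) (reject m F) (none-chosen solR) free
    asR : List (Maybe ℕ)
    asR = proj₁ reserved
    servedR : Pointwise (Served (chosen solS)) (reject m F) asR
    servedR = proj₁ (proj₂ reserved)
    fewerR : ∀ w → uses w asR ≤ uses w (partners solR)
    fewerR = proj₂ (proj₂ reserved)
    joint-within : ∀ w → uses w (partners solS) + uses w asR ≤ cap w
    joint-within w with occurs? w S | within solR w
    ... | yes _   | noneR = begin
      uses w (partners solS) + uses w asR ≤⟨ +-monoʳ-≤ _ (≤-trans (fewerR w) noneR) ⟩
      uses w (partners solS) + 0          ≡⟨ +-identityʳ _ ⟩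
      uses w (partners solS)              ≤⟨ within solS w ⟩
      cap w                               ∎
      where open ≤-Reasoning
    ... | no w∉S  | onlyR = begin
      uses w (partners solS) + uses w asR ≡⟨ cong (_+ uses w asR) (uses-absent S (served solS) w∉S) ⟩
      uses w asR                          ≤⟨ fewerR w ⟩
      uses w (partners solR)              ≤⟨ onlyR ⟩
      cap w                               ∎
      where open ≤-Reasoning

  split : ∀ {n} → SolvableBelow n → ∀ cap d F → length F ≤ suc n → All WellFormed F → Hall cap d F →
          ∀ m → 0 < length (select m F) → 0 < length (reject m F) →
          capacity cap (select m F) + d ≤ length (select m F) → Solution cap d F
  split {n} solve cap d F len wf hall m 0<S 0<R tight = join F m (select-All m wf)
    (solve cap d S (shorter (m<m+n (length S) 0<R)) (select-All m wf) (Hall-select F m hall))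
    (solve (cap without S) 0 R (shorter (m<n+m (length R) 0<S)) (reject-All m wf)
           (Hall-reject F m hall tight))
    where
    S R : List Node
    S = select m F
    R = reject m F
    shorter : ∀ {k} → k < length S + length R → k ≤ n
    shorter k< = s≤s⁻¹ (<-≤-trans k< (≤-trans (≤-reflexive (length-select+reject m F)) len))

  prepend : ∀ {cap cap' d i F a} (sol : Solution cap' d F) → Served (chosen sol) i a →
            (∀ w → uses w (a ∷ partners sol) ≤ cap w) → Solution cap d (i ∷ F)
  prepend {a = a} sol s within' = record
    { chosen        = chosen sol
    ; partners      = a ∷ partners sol
    ; chosen-unique = chosen-unique sol
    ; chosen-few    = chosen-few sol
    ; chosen-good   = there ∘ chosen-good sol
    ; served        = s ∷ served sol
    ; within        = within'
    }

  decrement : ℕ → (ℕ → ℕ) → ℕ → ℕ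
  decrement v cap u = cap u ∸ indicator (u ≟ v) 1

  capacity-decrement : ∀ v cap S → capacity cap S ≤ suc (capacity (decrement v cap) S)
  capacity-decrement v cap S = begin
    capacity cap S
      ≤⟨ sumBelow-≤-+ B pointwise ⟩
    sumBelow B (λ u → indicator (u ≟ v) 1) + capacity (decrement v cap) S
      ≤⟨ +-monoˡ-≤ _ (sumBelow-at-≤ B (λ _ → 1) v) ⟩
    suc (capacity (decrement v cap) S)
      ∎
    where
    open ≤-Reasoning
    pointwise : ∀ u → indicator (occurs? u S) (cap u) ≤
                      indicator (u ≟ v) 1 + indicator (occurs? u S) (decrement v cap u)
    pointwise u with occurs? u S
    ... | yes _ = m≤n+m∸n (cap u) (indicator (u ≟ v) 1)
    ... | no _  = z≤n

  uses-decrement : ∀ v cap → 0 < cap v → ∀ w → indicator (w ≟ v) 1 + decrement v cap w ≤ cap w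
  uses-decrement v cap pos w with w ≟ v
  ... | yes refl = ≤-reflexive (m+[n∸m]≡n pos)
  ... | no _     = ≤-refl

  StrictHall⇒Hall-decrement : ∀ {cap d} F v → StrictHall cap d F → Hall (decrement v cap) d F
  StrictHall⇒Hall-decrement {cap} {d} F v strict m =
    ≤-if-positive λ pos →
      s≤s⁻¹ (<-≤-trans (strict m pos) (+-monoˡ-≤ d (capacity-decrement v cap (select m F))))

  assign : ∀ {n} → SolvableBelow n → ∀ cap d i F → length F ≤ n → All WellFormed F → StrictHall cap d F →
           ∀ v → 0 < cap v → v ∈ nbrs i → v ∈ good i ⊎ d ≡ 0 → Solution cap d (i ∷ F)
  assign solve cap d i F len wf strict v pos v∈ good-or-0 =
    extend (solve (decrement v cap) d F len wf (StrictHall⇒Hall-decrement F v strict))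
    where
    extend : Solution (decrement v cap) d F → Solution cap d (i ∷ F)
    extend sol with hit? (chosen sol) i
    ... | yes h = prepend sol (hit h) λ w → ≤-trans (within sol w) (m∸n≤m (cap w) (indicator (w ≟ v) 1))
    ... | no ¬h = prepend sol (matched v∈ v∉ ¬h) λ w →
                    ≤-trans (+-monoʳ-≤ _ (within sol w)) (uses-decrement v cap pos w)
      where
      v∉ : v ∉ chosen sol
      v∉ = [ (λ v∈good → ¬h ∘ lose v∈good) , (λ { refl → ∉-short (chosen-few sol) }) ] good-or-0

  capacity-strip : ∀ {g} cap S → cap g ≡ 0 → capacity cap S ≤ capacity cap (map (strip g) S)
  capacity-strip {g} cap S cap-g≡0 = sumBelow-mono-≤ B pointwise
    where
    pointwise : ∀ u → indicator (occurs? u S) (cap u) ≤ indicator (occurs? u (map (strip g) S)) (cap u)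
    pointwise u with u ≟ g
    ... | yes refl = ≤-trans (≤-trans (indicator-≤ (occurs? u S) (cap u)) (≤-reflexive cap-g≡0)) z≤n
    ... | no u≢g   = indicator-mono (occurs? u S) (occurs? u _) (λ occ → Occurs-strip g S occ u≢g) (cap u)

  StrictHall⇒Hall-delete : ∀ {cap d} F g → cap g ≡ 0 → StrictHall cap (suc d) F → Hall cap d (delete g F)
  StrictHall⇒Hall-delete {cap} {d} F g cap-g≡0 strict m with select-delete g m F
  ... | m₀ , eq rewrite eq | length-map (strip g) (select m₀ F) =
    ≤-if-positive λ pos → s≤s⁻¹ (≤-trans (strict m₀ pos)
      (≤-trans (+-monoˡ-≤ (suc d) (capacity-strip cap (select m₀ F) cap-g≡0)) (≤-reflexive (+-suc _ d))))

  choose : ∀ {n} → SolvableBelow n → ∀ cap d i F → length F ≤ n → All WellFormed F →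
           StrictHall cap (suc d) F → ∀ g → g ∈ good i → cap g ≡ 0 → Solution cap (suc d) (i ∷ F)
  choose solve cap d i F len wf strict g g∈ cap-g≡0 = record
    { chosen        = g ∷ chosen sol
    ; partners      = nothing ∷ proj₁ reinstated
    ; chosen-unique = ¬Any⇒All¬ _ g∉ ∷ chosen-unique sol
    ; chosen-few    = s≤s (chosen-few sol)
    ; chosen-good   = λ { (here refl) → here g∈
                        ; (there x∈)  → there (IsGood-delete⁻ g F (chosen-good sol x∈)) }
    ; served        = hit (lose g∈ (here refl)) ∷ proj₁ (proj₂ reinstated)
    ; within        = λ w → ≤-trans (proj₂ (proj₂ reinstated) w) (within sol w)
    }
    where
    sol : Solution cap d (delete g F)
    sol = solve cap d (delete g F) (≤-trans (length-delete g F) len) (WellFormed-delete g wf)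
                (StrictHall⇒Hall-delete F g cap-g≡0 strict)
    g∉ : g ∉ chosen sol
    g∉ g∈V = ¬IsGood-delete g F (chosen-good sol g∈V)
    reinstated : ∃ λ as → Pointwise (Served (g ∷ chosen sol)) F as ×
                          (∀ w → uses w as ≤ uses w (partners sol))
    reinstated = reinstate g F (served sol)

  positive-neighbour : ∀ cap i F → Hall cap 0 (i ∷ F) → ∃ λ u → u ∈ nbrs i × 0 < cap u
  positive-neighbour cap i F hall
    with sumBelow-positive B _ (≤-trans (hall (true ∷ [])) (≤-reflexive (+-identityʳ _)))
  ... | u , pos with indicator-positive (occurs? u (i ∷ [])) pos
  ... | here u∈ , cap-pos = u , u∈ , cap-pos

  solve-strict : ∀ {n} → SolvableBelow n → ∀ cap d i F → length F ≤ n → All WellFormed (i ∷ F) →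
               Hall cap d (i ∷ F) → StrictHall cap d F → Solution cap d (i ∷ F)
  solve-strict solve cap zero i F len (_ ∷ wf) hall strict =
    let u , u∈ , pos = positive-neighbour cap i F hall in
    assign solve cap zero i F len wf strict u pos u∈ (inj₂ refl)
  solve-strict solve cap (suc d) i F len ((good⊆nbrs , g , g∈) ∷ wf) _ strict with cap g ≟ 0
  ... | yes cap-g≡0 = choose solve cap d i F len wf strict g g∈ cap-g≡0
  ... | no cap-g≢0  =
    assign solve cap (suc d) i F len wf strict g (n≢0⇒n>0 cap-g≢0) (good⊆nbrs g∈) (inj₁ g∈)

  TightSplit : (ℕ → ℕ) → ℕ → List Node → List Bool → Set
  TightSplit cap d F m =
    0 < length (select m F) × 0 < length (reject m F) × capacity cap (select m F) + d ≤ length (select m F)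

  tightSplit? : ∀ cap d F m → Dec (TightSplit cap d F m)
  tightSplit? cap d F m =
    0 <? length (select m F) ×-dec 0 <? length (reject m F) ×-dec
    capacity cap (select m F) + d ≤? length (select m F)

  -- A part of F not containing i is a proper part of i ∷ F.
  no-TightSplit⇒StrictHall : ∀ {cap d i F} →
    (∀ (s : Vec Bool (suc (length F))) → ¬ TightSplit cap d (i ∷ F) (toList s)) → StrictHall cap d F
  no-TightSplit⇒StrictHall {cap} {d} {i} {F} none m pos = ≰⇒> λ tight →
    none (false ∷ᵛ fit (length F) m)
      (subst (λ S → 0 < length S) eq pos , s≤s z≤n , subst (λ S → capacity cap S + d ≤ length S) eq tight)
    where
    eq : select m F ≡ select (toList (fit (length F) m)) F
    eq = sym (select-fit m F)

  solve : ∀ n → SolvableBelow n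
  solve n       cap d []      _  _  _    = record
    { chosen = [] ; partners = [] ; chosen-unique = [] ; chosen-few = z≤n
    ; chosen-good = λ () ; served = [] ; within = λ _ → z≤n }
  solve zero    cap d (i ∷ F) () _  _
  solve (suc n) cap d (i ∷ F) len wf hall
    with anySubset? {n = suc (length F)} (λ s → tightSplit? cap d (i ∷ F) (toList s))
  ... | yes (s , 0<S , 0<R , tight) = split (solve n) cap d (i ∷ F) len wf hall (toList s) 0<S 0<R tight
  ... | no ∄tight = solve-strict (solve n) cap d i F (s≤s⁻¹ len) wf hall
                      (no-TightSplit⇒StrictHall λ s tight → ∄tight (s , tight))

  deficientHall : ∀ cap d F → All WellFormed F → Hall cap d F → Solution cap d F
  deficientHall cap d F = solve (length F) cap d F ≤-refl

δ≤δ* : ∀ dom F m → δ dom (select m F) ℤ.≤ δ* dom F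
δ≤δ* dom F m = foldr-⊔-≥ (map (δ dom) (subs F)) (∈-map⁺ (δ dom) (select∈subs m F))
  where
  foldr-⊔-≥ : ∀ {x b} xs → x ∈ xs → x ℤ.≤ foldr ℤ._⊔_ b xs
  foldr-⊔-≥ (y ∷ xs) (here refl) = ℤ.i≤i⊔j y _
  foldr-⊔-≥ (y ∷ xs) (there x∈)  = ℤ.≤-trans (foldr-⊔-≥ xs x∈) (ℤ.i≤j⊔i y _)

0≤δ* : ∀ dom F → ℤ.0ℤ ℤ.≤ δ* dom F
0≤δ* dom F = foldr-⊔-≥-base (map (δ dom) (subs F))
  where
  foldr-⊔-≥-base : ∀ xs → δ dom [] ℤ.≤ foldr ℤ._⊔_ (δ dom []) xs
  foldr-⊔-≥-base []       = ℤ.≤-refl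
  foldr-⊔-≥-base (y ∷ xs) = ℤ.≤-trans (foldr-⊔-≥-base xs) (ℤ.i≤j⊔i y _)

c≤rd+δ : ∀ dom S d → δ dom S ℤ.≤ ℤ.+ d → c S ≤ rd dom S + d
c≤rd+δ dom S d δ≤d = ℤ.drop‿+≤+ (begin
  ℤ.+ c S                                      ≡⟨ //-rightDividesˡ (ℤ.+ rd dom S) (ℤ.+ c S) ⟨
  ℤ.+ c S ℤ.- ℤ.+ rd dom S ℤ.+ ℤ.+ rd dom S    ≤⟨ ℤ.+-monoˡ-≤ (ℤ.+ rd dom S) δ≤d ⟩
  ℤ.+ d ℤ.+ ℤ.+ rd dom S                       ≡⟨ ℤ.+-comm (ℤ.+ d) (ℤ.+ rd dom S) ⟩
  ℤ.+ (rd dom S + d)                           ∎)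
  where open ℤ.≤-Reasoning

∈⇒≤sum : ∀ {x} xs → x ∈ xs → x ≤ sum xs
∈⇒≤sum (y ∷ xs) (here refl) = m≤m+n y _
∈⇒≤sum (y ∷ xs) (there x∈)  = ≤-trans (∈⇒≤sum xs x∈) (m≤n+m _ y)

sum-≤-sumBelow : ∀ n (f : ℕ → ℕ) D → Unique D → (∀ {x} → x ∈ D → x < n) →
                 sum (map f D) ≤ sumBelow n (λ u → indicator (u ∈? D) (f u))
sum-≤-sumBelow n f []      _            _     = z≤n
sum-≤-sumBelow n f (x ∷ D) (x∉D ∷ uniq) below = begin
  f x + sum (map f D)
    ≤⟨ +-mono-≤ (sumBelow-at-≥ n f (below (here refl))) (sum-≤-sumBelow n f D uniq (below ∘ there)) ⟩
  sumBelow n (λ u → indicator (u ≟ x) (f u)) + sumBelow n (λ u → indicator (u ∈? D) (f u))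
    ≡⟨ sumBelow-+ n _ _ ⟨
  sumBelow n (λ u → indicator (u ≟ x) (f u) + indicator (u ∈? D) (f u))
    ≤⟨ sumBelow-mono-≤ n disjoint ⟩
  sumBelow n (λ u → indicator (u ∈? x ∷ D) (f u))
    ∎
  where
  open ≤-Reasoning
  disjoint : ∀ u → indicator (u ≟ x) (f u) + indicator (u ∈? D) (f u) ≤ indicator (u ∈? x ∷ D) (f u)
  disjoint u = indicator-+ (u ≟ x) (u ∈? D) (u ∈? x ∷ D) here there (λ { refl → All¬⇒¬Any x∉D }) (f u)

look-here : ∀ v x φ → look ((v , x) ∷ φ) v ≡ just x
look-here v x φ with v ≡ᵇ v | ≡⇒≡ᵇ v v refl
... | true  | _  = refl
... | false | ()

look-there : ∀ {v w} x φ → v ≢ w → look ((w , x) ∷ φ) v ≡ look φ v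
look-there {v} {w} x φ v≢w with v ≡ᵇ w in eq
... | true  = ⊥-elim (v≢w (≡ᵇ⇒≡ v w (subst T (sym eq) tt)))
... | false = refl

look-valid : ∀ (dom : ℕ → ℕ) {ψ : PAss} {v x} →
             All (λ p → proj₂ p < dom (proj₁ p)) ψ → look ψ v ≡ just x → x < dom v
look-valid dom {(w , y) ∷ ψ} {v} (y<dom ∷ valid) eq with v ≡ᵇ w in v≡ᵇw
... | false = look-valid dom valid eq
... | true with ≡ᵇ⇒≡ v w (subst T (sym v≡ᵇw) tt) | eq
...   | refl | refl = y<dom

satLit-look : ∀ φ ψ {v} ε → look φ v ≡ look ψ v → satLit φ (v , ε) ≡ satLit ψ (v , ε)
satLit-look φ ψ {v} ε eq with look φ v | look ψ v | eq
... | _ | _ | refl = refl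

satLit-unassigned : ∀ φ {v} ε → look φ v ≡ nothing → satLit φ (v , ε) ≡ false
satLit-unassigned φ {v} ε eq with look φ v | eq
... | _ | refl = refl

falLit-unassigned : ∀ φ {v} ε → look φ v ≡ nothing → falLit φ (v , ε) ≡ false
falLit-unassigned φ {v} ε eq with look φ v | eq
... | _ | refl = refl

satLit⇒assigned : ∀ ψ {v} ε → T (satLit ψ (v , ε)) → ∃ λ y → look ψ v ≡ just y
satLit⇒assigned ψ {v} ε sat with look ψ v
... | just y = y , refl

-- The default 0 is never used: we only restrict to variables that ψ assigns.
restrict : PAss → List ℕ → PAss
restrict ψ V = map (λ v → v , fromMaybe 0 (look ψ v)) V

keys-restrict : ∀ ψ V → map proj₁ (restrict ψ V) ≡ V
keys-restrict ψ V = trans (sym (map-∘ V)) (map-id V)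

look-restrict-∈ : ∀ ψ {v} V → v ∈ V → look (restrict ψ V) v ≡ just (fromMaybe 0 (look ψ v))
look-restrict-∈ ψ {v} (w ∷ V) v∈ with v ≟ w
... | yes refl = look-here v _ (restrict ψ V)
... | no v≢w with v∈
...   | here v≡w  = ⊥-elim (v≢w v≡w)
...   | there v∈V = trans (look-there _ (restrict ψ V) v≢w) (look-restrict-∈ ψ V v∈V)

look-restrict-∉ : ∀ ψ {v} V → v ∉ V → look (restrict ψ V) v ≡ nothing
look-restrict-∉ ψ []      v∉ = refl
look-restrict-∉ ψ (w ∷ V) v∉ =
  trans (look-there _ (restrict ψ V) (v∉ ∘ here)) (look-restrict-∉ ψ V (v∉ ∘ there))

applyClause-satisfied : ∀ φ C → T (any (satLit φ) C) → applyClause φ C ≡ []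
applyClause-satisfied φ C sat with any (satLit φ) C
... | true = refl

applyClause-unsatisfied : ∀ φ C → ¬ T (any (satLit φ) C) →
                          applyClause φ C ≡ filter (λ l → T? (not (falLit φ l))) C ∷ []
applyClause-unsatisfied φ C ¬sat with any (satLit φ) C
... | true  = ⊥-elim (¬sat tt)
... | false = refl

insert : ℕ → Clause → List (ℕ × MCS) → List (ℕ × MCS)
insert w C []             = (w , C ∷ []) ∷ []
insert w C ((u , G) ∷ ps) with w ≟ u
... | yes _ = (u , C ∷ G) ∷ ps
... | no _  = (u , G) ∷ insert w C ps

All-keys-insert : ∀ {Q : ℕ → Set} w C ps → All Q (map proj₁ ps) → Q w → All Q (map proj₁ (insert w C ps))
All-keys-insert w C []             _        q = q ∷ []
All-keys-insert w C ((u , G) ∷ ps) (qu ∷ qs) q with w ≟ u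
... | yes _ = qu ∷ qs
... | no _  = qu ∷ All-keys-insert w C ps qs q

Unique-insert : ∀ w C ps → Unique (map proj₁ ps) → Unique (map proj₁ (insert w C ps))
Unique-insert w C []             _          = [] ∷ []
Unique-insert w C ((u , G) ∷ ps) (u∉ ∷ uniq) with w ≟ u
... | yes _   = u∉ ∷ uniq
... | no w≢u  = All-keys-insert w C ps u∉ (w≢u ∘ sym) ∷ Unique-insert w C ps uniq

concat-insert : ∀ w C ps → concat (map proj₂ (insert w C ps)) ↭ C ∷ concat (map proj₂ ps)
concat-insert w C []             = ↭-refl
concat-insert w C ((u , G) ∷ ps) with w ≟ u
... | yes _ = ↭-refl
... | no _  = ↭-trans (++⁺ˡ G (concat-insert w C ps)) (shift C G _)

Part : List (Maybe ℕ) → ℕ × MCS → Set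
Part as p = All (λ C → proj₁ p ∈ map proj₁ C) (proj₂ p) × length (proj₂ p) ≤ uses (proj₁ p) as

Part-∷ : ∀ a as {p} → Part as p → Part (a ∷ as) p
Part-∷ a as {p} (contains , size) = contains , ≤-trans size (uses-∷ (proj₁ p) a as)

Part-insert : ∀ w C as ps → All (Part as) ps → w ∈ map proj₁ C → All (Part (just w ∷ as)) (insert w C ps)
Part-insert w C as []             []                      w∈ =
  (w∈ ∷ [] , subst (1 ≤_) (sym (uses-self w as)) (s≤s z≤n)) ∷ []
Part-insert w C as ((u , G) ∷ ps) ((contains , size) ∷ parts) w∈ with w ≟ u
... | yes refl =
  (w∈ ∷ contains , ≤-trans (s≤s size) (≤-reflexive (sym (uses-self w as)))) ∷ mapAll (Part-∷ (just w) as) parts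
... | no _     = Part-∷ (just w) as (contains , size) ∷ Part-insert w C as ps parts w∈

-- Clauses as nodes

module Reduction (dom : ℕ → ℕ) (F : MCS) (ψ : PAss) where

  satVars : Clause → List ℕ
  satVars C = map proj₁ (filter (T? ∘ satLit ψ) C)

  toNode : Clause → Node
  toNode C = node (map proj₁ C) (satVars C)

  satVar-literal : ∀ {x} C → x ∈ satVars C → ∃ λ ε → (x , ε) ∈ C × T (satLit ψ (x , ε))
  satVar-literal C x∈ with ∈-map∘filter⁻ proj₁ (T? ∘ satLit ψ) {xs = C} x∈
  ... | (x , ε) , l∈ , refl , sat = ε , l∈ , sat

  WellFormed-toNode : ∀ {C} → T (any (satLit ψ) C) → WellFormed (toNode C)
  WellFormed-toNode {C} sat = (λ x∈ → let ε , l∈ , _ = satVar-literal C x∈ in ∈-map⁺ proj₁ l∈) , nonEmpty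
    where
    nonEmpty : ∃ (_∈ satVars C)
    nonEmpty with find (Any.any⁻ (satLit ψ) C sat)
    ... | l , l∈ , t = proj₁ l , ∈-map⁺ proj₁ (∈-filter⁺ (T? ∘ satLit ψ) l∈ t)

  IsGood⇒assigned : ∀ {x} G → IsGood x (map toNode G) → ∃ λ y → look ψ x ≡ just y
  IsGood⇒assigned G good with find (Any.map⁻ good)
  ... | C , _ , x∈ = let ε , _ , sat = satVar-literal C x∈ in satLit⇒assigned ψ ε sat

  cap : ℕ → ℕ
  cap v = dom v ∸ 1

  d : ℕ
  d = ℤ.∣ δ* dom F ∣

  B : ℕ
  B = suc (sum (concatMap (map proj₁) F))

  open DeficientHall B

  rd≤capacity : ∀ m → rd dom (select m F) ≤ capacity cap (map toNode (select m F))
  rd≤capacity m = ≤-trans (sum-≤-sumBelow B cap D (deduplicate-! L) below)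
                          (sumBelow-mono-≤ B λ u → indicator-mono (u ∈? D) (occurs? u _) occurs (cap u))
    where
    L D : List ℕ
    L = concatMap (map proj₁) (select m F)
    D = deduplicate _≟_ L
    below : ∀ {x} → x ∈ D → x < B
    below x∈ = s≤s (∈⇒≤sum _ (∈-concatMap⁺ (map proj₁)
                   (select-Any m F (∈-concatMap⁻ (map proj₁) (∈-deduplicate⁻ _≟_ L x∈)))))
    occurs : ∀ {u} → u ∈ D → Occurs u (map toNode (select m F))
    occurs u∈ = Any.map⁺ (∈-concatMap⁻ (map proj₁) (∈-deduplicate⁻ _≟_ L u∈))

  Hall-nodes : Hall cap d (map toNode F)
  Hall-nodes m rewrite select-map toNode m F | length-map toNode (select m F) =
    ≤-trans (c≤rd+δ dom (select m F) d δ≤d) (+-monoˡ-≤ d (rd≤capacity m))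
    where
    δ≤d : δ dom (select m F) ℤ.≤ ℤ.+ d
    δ≤d = subst (δ dom (select m F) ℤ.≤_) (sym (ℤ.0≤i⇒+∣i∣≡i (0≤δ* dom F))) (δ≤δ* dom F m)

  module Restriction (V : List ℕ) (assigned : ∀ {x} → x ∈ V → ∃ λ y → look ψ x ≡ just y) where

    φ : PAss
    φ = restrict ψ V

    agree : ∀ {v} → v ∈ V → look φ v ≡ look ψ v
    agree {v} v∈ with assigned v∈
    ... | y , eq = trans (look-restrict-∈ ψ V v∈) (trans (cong (just ∘ fromMaybe 0) eq) (sym eq))

    WFPAss-restrict : All (λ p → proj₂ p < dom (proj₁ p)) ψ → Unique V → WFPAss dom φ
    WFPAss-restrict ψ-valid uniq = All.map⁺ (tabulate valid) , subst Unique (sym (keys-restrict ψ V)) uniq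
      where
      valid : ∀ {v} → v ∈ V → fromMaybe 0 (look ψ v) < dom v
      valid v∈ with assigned v∈
      ... | y , eq rewrite eq = look-valid dom ψ-valid eq

    hit⇒satisfied : ∀ C → Hit V (toNode C) → T (any (satLit φ) C)
    hit⇒satisfied C h with find h
    ... | x , x∈sat , x∈V =
      let ε , l∈ , sat = satVar-literal C x∈sat in
      Any.any⁺ (satLit φ) (lose l∈ (subst T (sym (satLit-look φ ψ ε (agree x∈V))) sat))

    unhit⇒unsatisfied : ∀ C → ¬ Hit V (toNode C) → ¬ T (any (satLit φ) C)
    unhit⇒unsatisfied C ¬h sat with find (Any.any⁻ (satLit φ) C sat)
    ... | (x , ε) , l∈ , satφ with x ∈? V
    ...   | no x∉V  = subst T (satLit-unassigned φ ε (look-restrict-∉ ψ V x∉V)) satφ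
    ...   | yes x∈V = ¬h (lose (∈-map⁺ proj₁ (∈-filter⁺ (T? ∘ satLit ψ) l∈ satψ)) x∈V)
      where
      satψ : T (satLit ψ (x , ε))
      satψ = subst T (satLit-look φ ψ ε (agree x∈V)) satφ

    residual : Clause → Clause
    residual C = filter (λ l → T? (not (falLit φ l))) C

    ∈-residual : ∀ {w} C → w ∈ map proj₁ C → w ∉ V → w ∈ map proj₁ (residual C)
    ∈-residual C w∈ w∉ with ∈-map⁻ proj₁ w∈
    ... | (w , ε) , l∈ , refl =
      ∈-map⁺ proj₁ (∈-filter⁺ (λ l → T? (not (falLit φ l))) l∈
                     (subst (T ∘ not) (sym (falLit-unassigned φ ε (look-restrict-∉ ψ V w∉))) tt))

    group : MCS → List (Maybe ℕ) → List (ℕ × MCS)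
    group (C ∷ G) (just w ∷ as)  = insert w (residual C) (group G as)
    group (C ∷ G) (nothing ∷ as) = group G as
    group _       _              = []

    Unique-group : ∀ G {as} → Pointwise (Served V) (map toNode G) as → Unique (map proj₁ (group G as))
    Unique-group []      []                 = []
    Unique-group (C ∷ G) (hit _ ∷ ss)       = Unique-group G ss
    Unique-group (C ∷ G) {just w ∷ as} (matched _ _ _ ∷ ss) =
      Unique-insert w (residual C) (group G as) (Unique-group G ss)

    concat-group : ∀ G {as} → Pointwise (Served V) (map toNode G) as →
                   concat (map proj₂ (group G as)) ↭ apply φ G
    concat-group []      []           = ↭-refl
    concat-group (C ∷ G) (hit h ∷ ss)
      rewrite applyClause-satisfied φ C (hit⇒satisfied C h) = concat-group G ss
    concat-group (C ∷ G) {just w ∷ as} (matched _ _ ¬h ∷ ss)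
      rewrite applyClause-unsatisfied φ C (unhit⇒unsatisfied C ¬h) =
      ↭-trans (concat-insert w (residual C) (group G as)) (↭-prep (residual C) (concat-group G ss))

    Part-group : ∀ G {as} → Pointwise (Served V) (map toNode G) as → All (Part as) (group G as)
    Part-group []      []           = []
    Part-group (C ∷ G) {_ ∷ as} (hit _ ∷ ss) = Part-group G ss
    Part-group (C ∷ G) {just w ∷ as} (matched w∈ w∉ _ ∷ ss) =
      Part-insert w (residual C) as (group G as) (Part-group G ss) (∈-residual C w∈ w∉)

    matchingSat : (∀ v → 0 < dom v) → ∀ {as} → Pointwise (Served V) (map toNode F) as →
                  (∀ w → uses w as ≤ cap w) → MatchingSat dom (apply φ F)
    matchingSat dom-pos {as} ss within =
      group F as , Unique-group F ss , concat-group F ss , mapAll fits (Part-group F ss)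
      where
      fits : ∀ {p} → Part as p → All (λ C → proj₁ p ∈ map proj₁ C) (proj₂ p) × c (proj₂ p) < dom (proj₁ p)
      fits {w , _} (contains , size) =
        contains , ≤-<-trans (≤-trans size (within w)) (∸-monoʳ-< {o = 0} (s≤s z≤n) (dom-pos w))

corollary1p8p6 : (dom : ℕ → ℕ) → (∀ v → 0 < dom v) → (F : MCS) → WFMCS dom F → Satisfiable dom F → Σ PAss λ φ → WFPAss dom φ × (ℤ.+ nvar φ ℤ.≤ δ* dom F) × MatchingSat dom (apply φ F)
corollary1p8p6 dom dom-pos F _ (ψ , (ψ-valid , _) , ψ-sat) =
  φ , WFPAss-restrict ψ-valid (chosen-unique sol) , few , matchingSat dom-pos (served sol) (within sol)
  where
  open Reduction dom F ψ
  open DeficientHall B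
  open Solution
  sol : Solution cap d (map toNode F)
  sol = deficientHall cap d (map toNode F) (All.gmap⁺ WellFormed-toNode ψ-sat) Hall-nodes
  open Restriction (chosen sol) (IsGood⇒assigned F ∘ chosen-good sol)
  few : ℤ.+ nvar φ ℤ.≤ δ* dom F
  few = subst (ℤ.+ nvar φ ℤ.≤_) (ℤ.0≤i⇒+∣i∣≡i (0≤δ* dom F))
              (ℤ.+≤+ (≤-trans (≤-reflexive (length-map _ (chosen sol))) (chosen-few sol)))
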